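{- For every $\lambda$-term $t$: (1) $\mathrm{deg}(t)=\inf\{k\in\mathbb N\mid t\to_{\beta:k}u\text{ for some term }u\}$ (with $\inf\emptyset=\infty$). (2) Monotonicity: if $t\to_\beta s$ then $\mathrm{deg}(s)\geq\mathrm{deg}(t)$. (3) Invariance: if $t\to_{\neg\ell\ell}s$ then $\mathrm{deg}(s)=\mathrm{deg}(t)$.
   Context: $\lambda$-terms: $t::=x\mid\lambda x.t\mid ts$ (up to $\alpha$-equivalence); $t\{x:=s\}$ capture-avoiding substitution. $\beta$-reduction of level $k\in\mathbb N$: $(\lambda x.t)s\to_{\beta:0}t\{x:=s\}$; if $t\to_{\beta:k}t'$ then $\lambda x.t\to_{\beta:k}\lambda x.t'$, $ts\to_{\beta:k}t's$, and $st\to_{\beta:k+1}st'$. $\to_\beta=\bigcup_k\to_{\beta:k}$. Least level $\mathrm{deg}(t)\in\mathbb N\cup\{\infty\}$: $\mathrm{deg}(x)=\infty$, $\mathrm{deg}(\lambda x.t)=\mathrm{deg}(t)$, $\mathrm{deg}(ts)=0$ if $t$ is an abstraction, otherwise $\min\{\mathrm{deg}(t),\mathrm{deg}(s)+1\}$, with $\infty+1=\infty$. $t\to_{\neg\ell\ell}s$ iff $t\to_{\beta:k}s$ for some $k\in\mathbb N$ with $\mathrm{deg}(t)<k$. -}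

module Defs where

open import Data.Nat using (ℕ; zero; suc; _<_; _≤_; _<ᵇ_; _⊓_)
open import Data.Product using (Σ; _×_)
open import Data.Bool using (true; false)

-- λ-terms up to α-equivalence: de Bruijn indices.
data Term : Set where
  var : ℕ → Term
  lam : Term → Term
  app : Term → Term → Term

shift : ℕ → Term → Term
shift c (var x) with x <ᵇ c
... | true  = var x
... | false = var (suc x)
shift c (lam t) = lam (shift (suc c) t)
shift c (app t s) = app (shift c t) (shift c s)

-- capture-avoiding substitution of s for variable j, removing variable j
-- (the binder being contracted), variables above j decremented.
subst : ℕ → Term → Term → Term
subst j s (var x) with x <ᵇ j
... | true = var x
subst j s (var x) | false with x
... | zero = s  -- only reachable when j = 0
... | suc y with y <ᵇ j
...   | true  = s          -- x = j
...   | false = var y      -- x > j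
subst j s (lam t) = lam (subst (suc j) (shift 0 s) t)
subst j s (app t u) = app (subst j s t) (subst j s u)

_[_] : Term → Term → Term
t [ s ] = subst 0 s t

data _→β[_]_ : Term → ℕ → Term → Set where
  beta : ∀ {t s} → app (lam t) s →β[ 0 ] (t [ s ])
  ξlam : ∀ {t t' k} → t →β[ k ] t' → lam t →β[ k ] lam t'
  ξappL : ∀ {t t' s k} → t →β[ k ] t' → app t s →β[ k ] app t' s
  ξappR : ∀ {s t t' k} → t →β[ k ] t' → app s t →β[ suc k ] app s t'

_→β_ : Term → Term → Set
t →β s = Σ ℕ (λ k → t →β[ k ] s)

data ℕ∞ : Set where
  fin : ℕ → ℕ∞
  ∞   : ℕ∞

suc∞ : ℕ∞ → ℕ∞
suc∞ (fin n) = fin (suc n)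
suc∞ ∞ = ∞

min∞ : ℕ∞ → ℕ∞ → ℕ∞
min∞ (fin m) (fin n) = fin (m ⊓ n)
min∞ (fin m) ∞ = fin m
min∞ ∞ n = n

data _≤∞_ : ℕ∞ → ℕ∞ → Set where
  fin≤fin : ∀ {m n} → m ≤ n → fin m ≤∞ fin n
  ≤∞-top  : ∀ {a} → a ≤∞ ∞

data _<∞_ : ℕ∞ → ℕ∞ → Set where
  fin<fin : ∀ {m n} → m < n → fin m <∞ fin n
  fin<∞   : ∀ {m} → fin m <∞ ∞

deg : Term → ℕ∞
deg (var x) = ∞
deg (lam t) = deg t
deg (app (lam t) s) = fin 0
deg (app t s) = min∞ (deg t) (suc∞ (deg s))

_→¬ℓℓ_ : Term → Term → Set
t →¬ℓℓ s = Σ ℕ (λ k → (deg t <∞ fin k) × (t →β[ k ] s))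

module Submission where

-- The only cases that
-- need care are steps inside the head t of an application app t s, where the
-- step may create a redex (turning t into an abstraction).  Such a step is a
-- head contraction and hence has level 0 (`λ-creating-step-has-level-0`).

open import Defs
open import Data.Nat using (ℕ; suc; _<?_; z≤n; s≤s)
open import Data.Nat.Properties
  using (≤-refl; ≤-trans; <⇒≤; <-≤-trans; <-irrefl; ≮⇒≥; ⊓-sel; ⊓-comm; ⊓-glb;
         m⊓n≤m; m≥n⇒m⊓n≡n)
open import Data.Product using (Σ; _×_; _,_)
open import Data.Sum using (_⊎_; inj₁; inj₂)
open import Data.Empty using (⊥-elim)
open import Relation.Nullary using (¬_; yes; no)
open import Relation.Binary.PropositionalEquality
  using (_≡_; refl; sym; trans; cong)
  renaming (subst to transport)
open Relation.Binary.PropositionalEquality.≡-Reasoning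

≤∞-refl : ∀ {a} → a ≤∞ a
≤∞-refl {fin n} = fin≤fin ≤-refl
≤∞-refl {∞}     = ≤∞-top

≤∞-trans : ∀ {a b c} → a ≤∞ b → b ≤∞ c → a ≤∞ c
≤∞-trans (fin≤fin p) (fin≤fin q) = fin≤fin (≤-trans p q)
≤∞-trans _           ≤∞-top      = ≤∞-top

0≤∞ : ∀ {a} → fin 0 ≤∞ a
0≤∞ {fin n} = fin≤fin z≤n
0≤∞ {∞}     = ≤∞-top

≮∞0 : ∀ {a} → ¬ (a <∞ fin 0)
≮∞0 (fin<fin ())

<∞-≤∞-trans : ∀ {a b c} → a <∞ b → b ≤∞ c → a ≤∞ c
<∞-≤∞-trans (fin<fin p) (fin≤fin q) = fin≤fin (≤-trans (<⇒≤ p) q)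
<∞-≤∞-trans _           ≤∞-top      = ≤∞-top

<∞-≤∞-absurd : ∀ {a c} → a <∞ c → ¬ (c ≤∞ a)
<∞-≤∞-absurd (fin<fin p) (fin≤fin q) = <-irrefl refl (<-≤-trans p q)

<∞-or-≥∞ : ∀ a c → a <∞ fin c ⊎ fin c ≤∞ a
<∞-or-≥∞ (fin n) c with n <? c
... | yes n<c = inj₁ (fin<fin n<c)
... | no  n≮c = inj₂ (fin≤fin (≮⇒≥ n≮c))
<∞-or-≥∞ ∞       c = inj₂ ≤∞-top

suc∞-mono : ∀ {a b} → a ≤∞ b → suc∞ a ≤∞ suc∞ b
suc∞-mono (fin≤fin p) = fin≤fin (s≤s p)
suc∞-mono ≤∞-top      = ≤∞-top

suc∞-<-reflect : ∀ {a k} → suc∞ a <∞ fin (suc k) → a <∞ fin k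
suc∞-<-reflect {fin n} (fin<fin (s≤s p)) = fin<fin p

suc∞-fin-inv : ∀ a {k} → suc∞ a ≡ fin k → Σ ℕ (λ j → (k ≡ suc j) × (a ≡ fin j))
suc∞-fin-inv (fin n) refl = n , refl , refl

min∞-comm : ∀ a b → min∞ a b ≡ min∞ b a
min∞-comm (fin m) (fin n) = cong fin (⊓-comm m n)
min∞-comm (fin m) ∞       = refl
min∞-comm ∞       (fin n) = refl
min∞-comm ∞       ∞       = refl

min∞-sel : ∀ a b → min∞ a b ≡ a ⊎ min∞ a b ≡ b
min∞-sel (fin m) (fin n) with ⊓-sel m n
... | inj₁ e = inj₁ (cong fin e)
... | inj₂ e = inj₂ (cong fin e)
min∞-sel (fin m) ∞ = inj₁ refl
min∞-sel ∞       b = inj₂ refl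

min∞-≤ˡ : ∀ a b → min∞ a b ≤∞ a
min∞-≤ˡ (fin m) (fin n) = fin≤fin (m⊓n≤m m n)
min∞-≤ˡ (fin m) ∞       = ≤∞-refl
min∞-≤ˡ ∞       b       = ≤∞-top

min∞-≤ʳ : ∀ a b → min∞ a b ≤∞ b
min∞-≤ʳ a b = transport (_≤∞ b) (min∞-comm b a) (min∞-≤ˡ b a)

min∞-glb : ∀ {a b c} → c ≤∞ a → c ≤∞ b → c ≤∞ min∞ a b
min∞-glb {fin m} {fin n} (fin≤fin p) (fin≤fin q) = fin≤fin (⊓-glb p q)
min∞-glb {fin m} {∞}     p           _           = p
min∞-glb {∞}             _           q           = q

min∞-mono : ∀ {a a' b b'} → a ≤∞ a' → b ≤∞ b' → min∞ a b ≤∞ min∞ a' b'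
min∞-mono {a} {a'} {b} {b'} p q =
  min∞-glb (≤∞-trans (min∞-≤ˡ a b) p) (≤∞-trans (min∞-≤ʳ a b) q)

min∞-fin : ∀ a b {k} → min∞ a b ≡ fin k → a ≡ fin k ⊎ b ≡ fin k
min∞-fin a b e with min∞-sel a b
... | inj₁ e' = inj₁ (trans (sym e') e)
... | inj₂ e' = inj₂ (trans (sym e') e)

min∞-right : ∀ {a b} → b ≤∞ a → min∞ a b ≡ b
min∞-right (fin≤fin {n} {m} p) = cong fin (m≥n⇒m⊓n≡n p)
min∞-right {∞} ≤∞-top          = refl

min∞-<-right : ∀ {a b c} → min∞ a b <∞ c → c ≤∞ a → b <∞ c
min∞-<-right {a} {b} {c} lt c≤a with min∞-sel a b
... | inj₁ e = ⊥-elim (<∞-≤∞-absurd (transport (_<∞ c) e lt) c≤a)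
... | inj₂ e = transport (_<∞ c) e lt

-- Stability of the minimum: if min a b lies below the cut c, then replacing a
-- by a' ≥ a, with a' = a whenever a lies below the cut, does not change the
-- minimum (when a is not below the cut, b is the minimum on both sides).
min∞-stableˡ : ∀ {a a' b c} → min∞ a b <∞ fin c
             → (a <∞ fin c → a' ≡ a) → a ≤∞ a' → min∞ a' b ≡ min∞ a b
min∞-stableˡ {a} {a'} {b} {c} lt same a≤a' with <∞-or-≥∞ a c
... | inj₁ a<c = cong (λ x → min∞ x b) (same a<c)
... | inj₂ c≤a =
  let b<c = min∞-<-right lt c≤a
  in trans (min∞-right (<∞-≤∞-trans b<c (≤∞-trans c≤a a≤a')))
           (sym (min∞-right (<∞-≤∞-trans b<c c≤a)))

min∞-stableʳ : ∀ {a b b' c} → min∞ a b <∞ fin c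
             → (b <∞ fin c → b' ≡ b) → b ≤∞ b' → min∞ a b' ≡ min∞ a b
min∞-stableʳ {a} {b} {b'} {c} lt same b≤b' = begin
  min∞ a b'  ≡⟨ min∞-comm a b' ⟩
  min∞ b' a  ≡⟨ min∞-stableˡ (transport (_<∞ fin c) (min∞-comm a b) lt) same b≤b' ⟩
  min∞ b a   ≡⟨ min∞-comm b a ⟩
  min∞ a b   ∎

data IsLam : Term → Set where
  isLam : ∀ {t} → IsLam (lam t)

isLam? : (t : Term) → IsLam t ⊎ ¬ IsLam t
isLam? (var x)   = inj₂ (λ ())
isLam? (lam t)   = inj₁ isLam
isLam? (app t s) = inj₂ (λ ())

deg-app : ∀ t s → ¬ IsLam t → deg (app t s) ≡ min∞ (deg t) (suc∞ (deg s))
deg-app (var x)   s _      = refl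
deg-app (lam t)   s notLam = ⊥-elim (notLam isLam)
deg-app (app t u) s _      = refl

lam-step-is-lam : ∀ {t k u} → lam t →β[ k ] u → IsLam u
lam-step-is-lam (ξlam _) = isLam

-- A step turning a non-abstraction into an abstraction is a head β-contraction,
-- hence of level 0.
λ-creating-step-has-level-0 : ∀ {t k u} → t →β[ k ] u → ¬ IsLam t → IsLam u → k ≡ 0
λ-creating-step-has-level-0 beta     _      _  = refl
λ-creating-step-has-level-0 (ξlam _) notLam _  = ⊥-elim (notLam isLam)
λ-creating-step-has-level-0 (ξappL _) _     ()
λ-creating-step-has-level-0 (ξappR _) _     ()

level-bound : ∀ {t k u} → t →β[ k ] u → deg t ≤∞ fin k
level-bound beta     = 0≤∞
level-bound (ξlam r) = level-bound r
level-bound {app t s} (ξappL r) with isLam? t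
... | inj₁ isLam  = 0≤∞
... | inj₂ notLam rewrite deg-app t s notLam =
  ≤∞-trans (min∞-≤ˡ (deg t) _) (level-bound r)
level-bound {app t s} (ξappR r) with isLam? t
... | inj₁ isLam  = 0≤∞
... | inj₂ notLam rewrite deg-app t s notLam =
  ≤∞-trans (min∞-≤ʳ _ (suc∞ (deg s))) (suc∞-mono (level-bound r))

step-of-least-level : ∀ t k → deg t ≡ fin k → Σ Term (λ u → t →β[ k ] u)
step-of-least-level (lam t) k e with step-of-least-level t k e
... | u , r = lam u , ξlam r
step-of-least-level (app t s) k e with isLam? t
step-of-least-level (app (lam t) s) .0 refl | inj₁ isLam = t [ s ] , beta
... | inj₂ notLam with min∞-fin (deg t) (suc∞ (deg s)) (trans (sym (deg-app t s notLam)) e)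
...   | inj₁ head-deg with step-of-least-level t k head-deg
...     | u , r = app u s , ξappL r
step-of-least-level (app t s) k e | inj₂ notLam | inj₂ arg-deg
  with suc∞-fin-inv (deg s) arg-deg
...   | j , refl , e' with step-of-least-level s j e'
...     | u , r = app t u , ξappR r

deg-monotone : ∀ {t k u} → t →β[ k ] u → deg t ≤∞ deg u
deg-monotone beta     = 0≤∞
deg-monotone (ξlam r) = deg-monotone r
deg-monotone {app t s} {u = app t' _} (ξappL r) with isLam? t | isLam? t'
... | inj₁ isLam  | _ = 0≤∞
... | inj₂ notLam | inj₁ isLam rewrite deg-app t s notLam =
  ≤∞-trans (min∞-≤ˡ (deg t) _)
           (transport (λ k → deg t ≤∞ fin k)
                      (λ-creating-step-has-level-0 r notLam isLam) (level-bound r))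
... | inj₂ notLam | inj₂ notLam' rewrite deg-app t s notLam | deg-app t' s notLam' =
  min∞-mono (deg-monotone r) ≤∞-refl
deg-monotone {app t s} {u = app _ s'} (ξappR r) with isLam? t
... | inj₁ isLam  = 0≤∞
... | inj₂ notLam rewrite deg-app t s notLam | deg-app t s' notLam =
  min∞-mono ≤∞-refl (suc∞-mono (deg-monotone r))

-- In an application the
-- step changes one component, by (2) only upwards, and by induction not at all
-- when that component's degree is below the level; `min∞-stable` concludes.
deg-invariant : ∀ {t k u} → deg t <∞ fin k → t →β[ k ] u → deg u ≡ deg t
deg-invariant lt beta     = ⊥-elim (≮∞0 lt)
deg-invariant lt (ξlam r) = deg-invariant lt r
deg-invariant {app t s} {u = app t' _} lt (ξappL r) with isLam? t | isLam? t'
... | inj₁ isLam  | inj₁ isLam   = refl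
... | inj₁ isLam  | inj₂ notLam' = ⊥-elim (notLam' (lam-step-is-lam r))
... | inj₂ notLam | inj₁ isLam =
  ⊥-elim (≮∞0 (transport (λ k → deg (app t s) <∞ fin k)
                          (λ-creating-step-has-level-0 r notLam isLam) lt))
... | inj₂ notLam | inj₂ notLam' rewrite deg-app t s notLam | deg-app t' s notLam' =
  min∞-stableˡ lt (λ t<k → deg-invariant t<k r) (deg-monotone r)
deg-invariant {app t s} {u = app _ s'} lt (ξappR r) with isLam? t
... | inj₁ isLam  = refl
... | inj₂ notLam rewrite deg-app t s notLam | deg-app t s' notLam =
  min∞-stableʳ lt (λ s<k → cong suc∞ (deg-invariant (suc∞-<-reflect s<k) r))
                  (suc∞-mono (deg-monotone r))

proposition8 : (t : Term)
    → (((k : ℕ) (u : Term) → t →β[ k ] u → deg t ≤∞ fin k)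
       × ((k : ℕ) → deg t ≡ fin k → Σ Term (λ u → t →β[ k ] u)))
    × ((s : Term) → t →β s → deg t ≤∞ deg s)
    × ((s : Term) → t →¬ℓℓ s → deg s ≡ deg t)
proposition8 t =
  ( (λ k u r → level-bound r) , step-of-least-level t )
  , (λ s (k , r) → deg-monotone r)
  , (λ s (k , lt , r) → deg-invariant lt r)
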